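{- Let $X,Y,Z\in\mathbb{Z}[i]$ with $X,Z\in O^I$ and $Y=(1+i)^2W$ for some $W\in G$, and suppose $X^2+Y^2=Z^2$, $\gcd(X,Y)\in U$ and $XYZ\neq 0$. Then there exist an integer $t$ with $0\le t\le 3$ and $P,Q\in G$ with $\gcd(P,Q)=1$ and $PQ\equiv 0\pmod{1+i}$ such that $$X=i^{t+1}\bigl(P^2-(-1)^tQ^2\bigr),\quad Y=(1+i)^2PQ,\quad Z=i^{t+1}\bigl(P^2+(-1)^tQ^2\bigr).$$
   Context: $\mathbb{Z}[i]$ is the ring of Gaussian integers and $U=\{1,-1,i,-i\}$ its unit group. For $\alpha\in\mathbb{Z}[i]$, $R(\alpha)$ and $I(\alpha)$ denote its real and imaginary parts. $O^I=\{\alpha\in\mathbb{Z}[i]: R(\alpha)+I(\alpha)\equiv 1 \pmod 2,\ R(\alpha)\equiv 1 \pmod 4\}$. $G$ denotes the set of Gaussian integers of the form $(1+i)^{a_1}p_2^{a_2}\cdots p_m^{a_m}$ with integers $a_j\ge 0$ and $p_2,\dots,p_m$ distinct Gaussian primes belonging to $O^I$ (the empty product $1$ included). Congruences modulo $\mu$ mean divisibility by $\mu$ in $\mathbb{Z}[i]$; "$\gcd(a,b)=1$" or "$\in U$" means no common non-unit divisor. -}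

module Defs where

open import Data.Integer as ℤ using (ℤ; +_; -[1+_])
open import Data.Nat using (ℕ; zero; suc)
open import Data.Product using (Σ; _×_; _,_; ∃; proj₁)
open import Data.Sum using (_⊎_)
open import Data.List using (List; []; _∷_; map)
open import Data.List.Relation.Unary.All using (All)
open import Data.List.Relation.Unary.Unique.Propositional using (Unique)
open import Relation.Binary.PropositionalEquality using (_≡_)
open import Relation.Nullary using (¬_)

record ℤ[i] : Set where
  constructor _+_i
  field
    re : ℤ
    im : ℤ
open ℤ[i] public

infixl 6 _+ᵍ_ _-ᵍ_
infixl 7 _*ᵍ_
infixr 8 _^ᵍ_

_+ᵍ_ : ℤ[i] → ℤ[i] → ℤ[i]
(a + b i) +ᵍ (c + d i) = (a ℤ.+ c) + (b ℤ.+ d) i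

-ᵍ_ : ℤ[i] → ℤ[i]
-ᵍ (a + b i) = (ℤ.- a) + (ℤ.- b) i

_-ᵍ_ : ℤ[i] → ℤ[i] → ℤ[i]
x -ᵍ y = x +ᵍ (-ᵍ y)

_*ᵍ_ : ℤ[i] → ℤ[i] → ℤ[i]
(a + b i) *ᵍ (c + d i) = (a ℤ.* c ℤ.- b ℤ.* d) + (a ℤ.* d ℤ.+ b ℤ.* c) i

0ᵍ 1ᵍ iᵍ 1+iᵍ : ℤ[i]
0ᵍ = (+ 0) + (+ 0) i
1ᵍ = (+ 1) + (+ 0) i
iᵍ = (+ 0) + (+ 1) i
1+iᵍ = (+ 1) + (+ 1) i

_^ᵍ_ : ℤ[i] → ℕ → ℤ[i]
x ^ᵍ zero = 1ᵍ
x ^ᵍ suc n = x *ᵍ (x ^ᵍ n)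

_∣ᵍ_ : ℤ[i] → ℤ[i] → Set
μ ∣ᵍ α = Σ ℤ[i] λ κ → α ≡ κ *ᵍ μ

_∈U : ℤ[i] → Set
u ∈U = (u ≡ 1ᵍ) ⊎ (u ≡ -ᵍ 1ᵍ) ⊎ (u ≡ iᵍ) ⊎ (u ≡ -ᵍ iᵍ)

-- gcd(a,b) ∈ U : no common non-unit divisor
Coprimeᵍ : ℤ[i] → ℤ[i] → Set
Coprimeᵍ a b = ∀ d → d ∣ᵍ a → d ∣ᵍ b → d ∈U

GaussianPrime : ℤ[i] → Set
GaussianPrime p = ¬ (p ≡ 0ᵍ) × ¬ (p ∈U) × (∀ a b → p ≡ a *ᵍ b → (a ∈U) ⊎ (b ∈U))

data _≡_mod_ : ℤ → ℤ → ℕ → Set where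
  congr : ∀ {a b n} (k : ℤ) → a ℤ.- b ≡ k ℤ.* (+ n) → a ≡ b mod n

InOI : ℤ[i] → Set
InOI α = ((re α ℤ.+ im α) ≡ + 1 mod 2) × (re α ≡ + 1 mod 4)

prodPow : List (ℤ[i] × ℕ) → ℤ[i]
prodPow [] = 1ᵍ
prodPow ((p , a) ∷ ps) = (p ^ᵍ a) *ᵍ prodPow ps

InG : ℤ[i] → Set
InG α = Σ ℕ λ a₁ → Σ (List (ℤ[i] × ℕ)) λ ps →
          Unique (map proj₁ ps) ×
          All (λ pa → GaussianPrime (proj₁ pa) × InOI (proj₁ pa)) ps ×
          (α ≡ (1+iᵍ ^ᵍ a₁) *ᵍ prodPow ps)

-- Write X = M − N and Z = M + N with M = (X + Z)/2 and N = (Z − X)/2, Gaussian integers because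
-- X, Z ∈ O^I. Since Y = (1+i)² W = 2i W, the equation X² + Y² = Z² becomes M N = −W². A prime
-- dividing both M and N would divide X and Y, so M and N are coprime, and unique factorisation in
-- ℤ[i] (Euclid's lemma, from division with remainder for the norm) sends each prime power of W²
-- wholly into M or into N: M = u P², N = v Q² with P Q = W and P, Q ∈ G. Then u v = −1, so
-- u = i^(1+t) and v = u (−1)^t for some t ≤ 3. One of M, N is divisible by 1 + i, hence so is P Q = W.
module Submission where

open import Defs
open import Algebra.Bundles using (CommutativeRing)
open import Algebra.Structures using (IsCommutativeRing)
open import Data.Empty using (⊥; ⊥-elim)
open import Data.Integer using (ℤ; +_; -[1+_]; ∣_∣)
import Data.Integer as Int
import Data.Integer.DivMod as IntDivMod
import Data.Integer.Properties as Intₚ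
import Data.Integer.Tactic.RingSolver as ℤSolver
open import Data.List using (List; []; _∷_; map)
open import Data.List.Relation.Ternary.Interleaving.Propositional using (Interleaving; []; consˡ; consʳ; swap)
open import Data.List.Relation.Unary.All using (All; []; _∷_)
import Data.List.Relation.Unary.All as All
open import Data.List.Relation.Unary.AllPairs using (AllPairs; []; _∷_)
import Data.List.Relation.Unary.AllPairs.Properties as AllPairs
open import Data.List.Relation.Unary.Unique.Propositional using (Unique)
open import Data.Maybe using (Maybe; just; nothing)
open import Data.Nat using (ℕ; zero; suc; z≤n; s≤s; _≤_; _<_)
import Data.Nat as Nat
import Data.Nat.Divisibility as Natᵈ
import Data.Nat.Induction as Natᵢ
import Data.Nat.Primality as Natᵖ
import Data.Nat.Properties as Natₚ
import Data.Nat.Tactic.RingSolver as ℕSolver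
open import Data.Product using (Σ; _×_; _,_; proj₁; proj₂)
open import Data.Sum using (_⊎_; inj₁; inj₂; [_,_]; reduce)
open import Function using (_on_)
open import Induction.WellFounded using (Acc; acc)
open import Level using (0ℓ)
import Relation.Binary.Construct.On as On
open import Relation.Binary.PropositionalEquality hiding ([_])
open import Relation.Nullary using (¬_; yes; no)
open import Relation.Nullary.Decidable using (from-yes)
import Tactic.RingSolver as Solver
import Tactic.RingSolver.Core.AlmostCommutativeRing as ACR

+ᵍ-assoc : ∀ x y z → (x +ᵍ y) +ᵍ z ≡ x +ᵍ (y +ᵍ z)
+ᵍ-assoc (a + b i) (c + d i) (e + f i) = cong₂ _+_i (Intₚ.+-assoc a c e) (Intₚ.+-assoc b d f)

+ᵍ-comm : ∀ x y → x +ᵍ y ≡ y +ᵍ x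
+ᵍ-comm (a + b i) (c + d i) = cong₂ _+_i (Intₚ.+-comm a c) (Intₚ.+-comm b d)

+ᵍ-identityˡ : ∀ x → 0ᵍ +ᵍ x ≡ x
+ᵍ-identityˡ (a + b i) = cong₂ _+_i (Intₚ.+-identityˡ a) (Intₚ.+-identityˡ b)

+ᵍ-identityʳ : ∀ x → x +ᵍ 0ᵍ ≡ x
+ᵍ-identityʳ (a + b i) = cong₂ _+_i (Intₚ.+-identityʳ a) (Intₚ.+-identityʳ b)

-ᵍ-inverseˡ : ∀ x → (-ᵍ x) +ᵍ x ≡ 0ᵍ
-ᵍ-inverseˡ (a + b i) = cong₂ _+_i (Intₚ.+-inverseˡ a) (Intₚ.+-inverseˡ b)

-ᵍ-inverseʳ : ∀ x → x +ᵍ (-ᵍ x) ≡ 0ᵍ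
-ᵍ-inverseʳ (a + b i) = cong₂ _+_i (Intₚ.+-inverseʳ a) (Intₚ.+-inverseʳ b)

*ᵍ-assoc : ∀ x y z → (x *ᵍ y) *ᵍ z ≡ x *ᵍ (y *ᵍ z)
*ᵍ-assoc (a + b i) (c + d i) (e + f i) = cong₂ _+_i (re-assoc a b c d e f) (im-assoc a b c d e f)
  where
  open Int using (_+_; _*_; _-_)
  re-assoc : ∀ a b c d e f →
    (a * c - b * d) * e - (a * d + b * c) * f ≡ a * (c * e - d * f) - b * (c * f + d * e)
  re-assoc = ℤSolver.solve-∀
  im-assoc : ∀ a b c d e f →
    (a * c - b * d) * f + (a * d + b * c) * e ≡ a * (c * f + d * e) + b * (c * e - d * f)
  im-assoc = ℤSolver.solve-∀

*ᵍ-comm : ∀ x y → x *ᵍ y ≡ y *ᵍ x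
*ᵍ-comm (a + b i) (c + d i) = cong₂ _+_i (re-comm a b c d) (im-comm a b c d)
  where
  open Int using (_+_; _*_; _-_)
  re-comm : ∀ a b c d → a * c - b * d ≡ c * a - d * b
  re-comm = ℤSolver.solve-∀
  im-comm : ∀ a b c d → a * d + b * c ≡ c * b + d * a
  im-comm = ℤSolver.solve-∀

*ᵍ-identityˡ : ∀ x → 1ᵍ *ᵍ x ≡ x
*ᵍ-identityˡ (a + b i) = cong₂ _+_i (re-identity a b) (im-identity a b)
  where
  open Int using (_+_; _*_; _-_)
  re-identity : ∀ a b → + 1 * a - + 0 * b ≡ a
  re-identity = ℤSolver.solve-∀
  im-identity : ∀ a b → + 1 * b + + 0 * a ≡ b
  im-identity = ℤSolver.solve-∀

*ᵍ-identityʳ : ∀ x → x *ᵍ 1ᵍ ≡ x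
*ᵍ-identityʳ x = trans (*ᵍ-comm x 1ᵍ) (*ᵍ-identityˡ x)

*ᵍ-distribˡ-+ᵍ : ∀ x y z → x *ᵍ (y +ᵍ z) ≡ x *ᵍ y +ᵍ x *ᵍ z
*ᵍ-distribˡ-+ᵍ (a + b i) (c + d i) (e + f i) = cong₂ _+_i (re-distrib a b c d e f) (im-distrib a b c d e f)
  where
  open Int using (_+_; _*_; _-_)
  re-distrib : ∀ a b c d e f → a * (c + e) - b * (d + f) ≡ (a * c - b * d) + (a * e - b * f)
  re-distrib = ℤSolver.solve-∀
  im-distrib : ∀ a b c d e f → a * (d + f) + b * (c + e) ≡ (a * d + b * c) + (a * f + b * e)
  im-distrib = ℤSolver.solve-∀

*ᵍ-distribʳ-+ᵍ : ∀ x y z → (y +ᵍ z) *ᵍ x ≡ y *ᵍ x +ᵍ z *ᵍ x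
*ᵍ-distribʳ-+ᵍ x y z = begin
  (y +ᵍ z) *ᵍ x      ≡⟨ *ᵍ-comm (y +ᵍ z) x ⟩
  x *ᵍ (y +ᵍ z)      ≡⟨ *ᵍ-distribˡ-+ᵍ x y z ⟩
  x *ᵍ y +ᵍ x *ᵍ z   ≡⟨ cong₂ _+ᵍ_ (*ᵍ-comm x y) (*ᵍ-comm x z) ⟩
  y *ᵍ x +ᵍ z *ᵍ x   ∎
  where open ≡-Reasoning

+ᵍ-*ᵍ-isCommutativeRing : IsCommutativeRing _≡_ _+ᵍ_ _*ᵍ_ -ᵍ_ 0ᵍ 1ᵍ
+ᵍ-*ᵍ-isCommutativeRing = record
  { isRing = record
    { +-isAbelianGroup = record
      { isGroup = record
        { isMonoid = record
          { isSemigroup = record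
            { isMagma = record { isEquivalence = isEquivalence ; ∙-cong = cong₂ _+ᵍ_ }
            ; assoc = +ᵍ-assoc }
          ; identity = +ᵍ-identityˡ , +ᵍ-identityʳ }
        ; inverse = -ᵍ-inverseˡ , -ᵍ-inverseʳ
        ; ⁻¹-cong = cong (λ x → -ᵍ x) }
      ; comm = +ᵍ-comm }
    ; *-cong = cong₂ _*ᵍ_
    ; *-assoc = *ᵍ-assoc
    ; *-identity = *ᵍ-identityˡ , *ᵍ-identityʳ
    ; distrib = *ᵍ-distribˡ-+ᵍ , *ᵍ-distribʳ-+ᵍ }
  ; *-comm = *ᵍ-comm }

+ᵍ-*ᵍ-commutativeRing : CommutativeRing 0ℓ 0ℓ
+ᵍ-*ᵍ-commutativeRing = record { isCommutativeRing = +ᵍ-*ᵍ-isCommutativeRing }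

ring : ACR.AlmostCommutativeRing 0ℓ 0ℓ
ring = ACR.fromCommutativeRing +ᵍ-*ᵍ-commutativeRing 0ᵍ≟
  where
  0ᵍ≟ : ∀ x → Maybe (0ᵍ ≡ x)
  0ᵍ≟ ((+ 0) + (+ 0) i) = just refl
  0ᵍ≟ _ = nothing

norm : ℤ[i] → ℕ
norm (a + b i) = ∣ a ∣ Nat.* ∣ a ∣ Nat.+ ∣ b ∣ Nat.* ∣ b ∣

normℤ : ℤ[i] → ℤ
normℤ (a + b i) = a Int.* a Int.+ b Int.* b

+∣i∣*∣i∣≡i*i : ∀ a → + (∣ a ∣ Nat.* ∣ a ∣) ≡ a Int.* a
+∣i∣*∣i∣≡i*i a with Intₚ.+∣i∣≡i⊎+∣i∣≡-i a
... | inj₁ eq = trans (Intₚ.pos-* ∣ a ∣ ∣ a ∣) (cong₂ Int._*_ eq eq)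
... | inj₂ eq = trans (Intₚ.pos-* ∣ a ∣ ∣ a ∣) (trans (cong₂ Int._*_ eq eq) (neg*neg a))
  where
  neg*neg : ∀ a → Int.- a Int.* Int.- a ≡ a Int.* a
  neg*neg = ℤSolver.solve-∀

+norm≡normℤ : ∀ x → + norm x ≡ normℤ x
+norm≡normℤ (a + b i) = trans (Intₚ.pos-+ (∣ a ∣ Nat.* ∣ a ∣) (∣ b ∣ Nat.* ∣ b ∣))
                              (cong₂ Int._+_ (+∣i∣*∣i∣≡i*i a) (+∣i∣*∣i∣≡i*i b))

normℤ-* : ∀ x y → normℤ (x *ᵍ y) ≡ normℤ x Int.* normℤ y
normℤ-* (a + b i) (c + d i) = brahmagupta a b c d
  where
  open Int using (_+_; _*_; _-_)
  brahmagupta : ∀ a b c d → (a * c - b * d) * (a * c - b * d) + (a * d + b * c) * (a * d + b * c)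
                          ≡ (a * a + b * b) * (c * c + d * d)
  brahmagupta = ℤSolver.solve-∀

norm-* : ∀ x y → norm (x *ᵍ y) ≡ norm x Nat.* norm y
norm-* x y = Intₚ.+-injective (begin
  + norm (x *ᵍ y)          ≡⟨ +norm≡normℤ (x *ᵍ y) ⟩
  normℤ (x *ᵍ y)           ≡⟨ normℤ-* x y ⟩
  normℤ x Int.* normℤ y    ≡⟨ cong₂ Int._*_ (+norm≡normℤ x) (+norm≡normℤ y) ⟨
  + norm x Int.* + norm y  ≡⟨ Intₚ.pos-* (norm x) (norm y) ⟨
  + (norm x Nat.* norm y)  ∎)
  where open ≡-Reasoning

norm≡0⇒≡0ᵍ : ∀ x → norm x ≡ 0 → x ≡ 0ᵍ
norm≡0⇒≡0ᵍ (a + b i) eq = cong₂ _+_i (Intₚ.∣i∣≡0⇒i≡0 (square≡0 ∣ a ∣ (Natₚ.m+n≡0⇒m≡0 _ eq)))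
                                     (Intₚ.∣i∣≡0⇒i≡0 (square≡0 ∣ b ∣ (Natₚ.m+n≡0⇒n≡0 _ eq)))
  where
  square≡0 : ∀ m → m Nat.* m ≡ 0 → m ≡ 0
  square≡0 zero _ = refl

norm≡1⇒∈U : ∀ x → norm x ≡ 1 → x ∈U
norm≡1⇒∈U ((+ 0) + (+ 0) i) ()
norm≡1⇒∈U ((+ 0) + (+ 1) i) _ = inj₂ (inj₂ (inj₁ refl))
norm≡1⇒∈U ((+ 0) + -[1+ 0 ] i) _ = inj₂ (inj₂ (inj₂ refl))
norm≡1⇒∈U ((+ 0) + (+ suc (suc n)) i) ()
norm≡1⇒∈U ((+ 0) + -[1+ suc n ] i) ()
norm≡1⇒∈U ((+ 1) + (+ 0) i) _ = inj₁ refl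
norm≡1⇒∈U (-[1+ 0 ] + (+ 0) i) _ = inj₂ (inj₁ refl)
norm≡1⇒∈U ((+ 1) + (+ suc n) i) ()
norm≡1⇒∈U ((+ 1) + -[1+ n ] i) ()
norm≡1⇒∈U (-[1+ 0 ] + (+ suc n) i) ()
norm≡1⇒∈U (-[1+ 0 ] + -[1+ n ] i) ()
norm≡1⇒∈U ((+ suc (suc m)) + b i) ()
norm≡1⇒∈U (-[1+ suc m ] + b i) ()

∈U⇒invertible : ∀ {u} → u ∈U → Σ ℤ[i] λ v → v *ᵍ u ≡ 1ᵍ
∈U⇒invertible (inj₁ refl) = 1ᵍ , refl
∈U⇒invertible (inj₂ (inj₁ refl)) = -ᵍ 1ᵍ , refl
∈U⇒invertible (inj₂ (inj₂ (inj₁ refl))) = -ᵍ iᵍ , refl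
∈U⇒invertible (inj₂ (inj₂ (inj₂ refl))) = iᵍ , refl

*ᵍ≡1ᵍ⇒∈U : ∀ x y → x *ᵍ y ≡ 1ᵍ → x ∈U
*ᵍ≡1ᵍ⇒∈U x y eq = norm≡1⇒∈U x (Natₚ.m*n≡1⇒m≡1 (norm x) (norm y) (trans (sym (norm-* x y)) (cong norm eq)))

*ᵍ≡0ᵍ⇒≡0ᵍ⊎≡0ᵍ : ∀ x y → x *ᵍ y ≡ 0ᵍ → x ≡ 0ᵍ ⊎ y ≡ 0ᵍ
*ᵍ≡0ᵍ⇒≡0ᵍ⊎≡0ᵍ x y eq with Natₚ.m*n≡0⇒m≡0∨n≡0 (norm x) (trans (sym (norm-* x y)) (cong norm eq))
... | inj₁ nx≡0 = inj₁ (norm≡0⇒≡0ᵍ x nx≡0)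
... | inj₂ ny≡0 = inj₂ (norm≡0⇒≡0ᵍ y ny≡0)

*ᵍ-cancelˡ : ∀ x y z → ¬ x ≡ 0ᵍ → x *ᵍ y ≡ x *ᵍ z → y ≡ z
*ᵍ-cancelˡ x y z x≢0 eq = y-z≡0⇒y≡z (x≢0⇒y-z≡0 (*ᵍ≡0ᵍ⇒≡0ᵍ⊎≡0ᵍ x (y +ᵍ -ᵍ z) x*[y-z]≡0))
  where
  distrib : ∀ x y z → x *ᵍ (y +ᵍ -ᵍ z) ≡ x *ᵍ y +ᵍ -ᵍ (x *ᵍ z)
  distrib = Solver.solve-∀ ring
  x*[y-z]≡0 : x *ᵍ (y +ᵍ -ᵍ z) ≡ 0ᵍ
  x*[y-z]≡0 = trans (distrib x y z) (trans (cong (λ t → t +ᵍ -ᵍ (x *ᵍ z)) eq) (-ᵍ-inverseʳ (x *ᵍ z)))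
  x≢0⇒y-z≡0 : x ≡ 0ᵍ ⊎ y +ᵍ -ᵍ z ≡ 0ᵍ → y +ᵍ -ᵍ z ≡ 0ᵍ
  x≢0⇒y-z≡0 (inj₁ x≡0) = ⊥-elim (x≢0 x≡0)
  x≢0⇒y-z≡0 (inj₂ y-z≡0) = y-z≡0
  y≡[y-z]+z : ∀ y z → y ≡ (y +ᵍ -ᵍ z) +ᵍ z
  y≡[y-z]+z = Solver.solve-∀ ring
  y-z≡0⇒y≡z : y +ᵍ -ᵍ z ≡ 0ᵍ → y ≡ z
  y-z≡0⇒y≡z y-z≡0 = trans (y≡[y-z]+z y z) (trans (cong (_+ᵍ z) y-z≡0) (+ᵍ-identityˡ z))

*ᵍ-cancelʳ : ∀ x y z → ¬ x ≡ 0ᵍ → y *ᵍ x ≡ z *ᵍ x → y ≡ z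
*ᵍ-cancelʳ x y z x≢0 eq = *ᵍ-cancelˡ x y z x≢0 (trans (*ᵍ-comm x y) (trans eq (*ᵍ-comm z x)))

∣ᵍ-refl : ∀ x → x ∣ᵍ x
∣ᵍ-refl x = 1ᵍ , sym (*ᵍ-identityˡ x)

∣ᵍ-trans : ∀ {x y z} → x ∣ᵍ y → y ∣ᵍ z → x ∣ᵍ z
∣ᵍ-trans {x} (k , refl) (l , refl) = l *ᵍ k , sym (*ᵍ-assoc l k x)

∣ᵍ-*ˡ : ∀ {x y} z → x ∣ᵍ y → x ∣ᵍ (z *ᵍ y)
∣ᵍ-*ˡ {x} z (k , refl) = z *ᵍ k , sym (*ᵍ-assoc z k x)

∣ᵍ-*ʳ : ∀ {x y} z → x ∣ᵍ y → x ∣ᵍ (y *ᵍ z)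
∣ᵍ-*ʳ {x} {y} z x∣y = subst (x ∣ᵍ_) (*ᵍ-comm z y) (∣ᵍ-*ˡ z x∣y)

∣ᵍ-+ᵍ : ∀ {x y z} → x ∣ᵍ y → x ∣ᵍ z → x ∣ᵍ (y +ᵍ z)
∣ᵍ-+ᵍ {x} (k , refl) (l , refl) = k +ᵍ l , sym (*ᵍ-distribʳ-+ᵍ x k l)

∣ᵍ-difference : ∀ {x y z} → x ∣ᵍ y → x ∣ᵍ z → x ∣ᵍ (y -ᵍ z)
∣ᵍ-difference {x} x∣y (l , refl) = ∣ᵍ-+ᵍ x∣y (-ᵍ l , neg-* l x)
  where
  neg-* : ∀ l x → -ᵍ (l *ᵍ x) ≡ (-ᵍ l) *ᵍ x
  neg-* = Solver.solve-∀ ring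

∣ᵍ-0ᵍ : ∀ x → x ∣ᵍ 0ᵍ
∣ᵍ-0ᵍ x = 0ᵍ , zero* x
  where
  zero* : ∀ x → 0ᵍ ≡ 0ᵍ *ᵍ x
  zero* = Solver.solve-∀ ring

∣r⊖n∣≤n : ∀ r n .{{_ : Nat.NonZero n}} → r < n Nat.+ n → ∣ r Int.⊖ n ∣ ≤ n
∣r⊖n∣≤n r n r<2n with Natₚ.≤-total r n
... | inj₁ r≤n rewrite Intₚ.∣⊖∣-≤ r≤n = Natₚ.m∸n≤m n r
... | inj₂ n≤r rewrite Intₚ.∣m⊖n∣≡∣n⊖m∣ r n | Intₚ.∣⊖∣-≤ n≤r = Natₚ.<⇒≤ (Natₚ.m<n+o⇒m∸n<o r n r<2n)

nearest-multiple : ∀ n m → Σ ℤ λ q → ∣ n Int.- q Int.* + suc m ∣ Nat.* 2 ≤ suc m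
nearest-multiple n m = q , bound
  where
  open Int using (_+_; _*_; _-_)
  k = n * + 2 + + suc m
  r = k Int.%ℕ (suc m Nat.+ suc m)
  q = k Int./ℕ (suc m Nat.+ suc m)
  k≡r+q*2m : k ≡ + r + q * (+ suc m + + suc m)
  k≡r+q*2m = trans (IntDivMod.a≡a%ℕn+[a/ℕn]*n k (suc m Nat.+ suc m))
                   (cong (λ t → + r + q * t) (Intₚ.pos-+ (suc m) (suc m)))
  twice-distance : ∀ n q r m → n * + 2 + m ≡ r + q * (m + m) → (n - q * m) * + 2 ≡ r - m
  twice-distance n q r m eq = trans (expand n q m) (trans (cong (λ t → t - q * (m + m) - m) eq) (cancel q r m))
    where
    expand : ∀ n q m → (n - q * m) * + 2 ≡ (n * + 2 + m) - q * (m + m) - m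
    expand = ℤSolver.solve-∀
    cancel : ∀ q r m → (r + q * (m + m)) - q * (m + m) - m ≡ r - m
    cancel = ℤSolver.solve-∀
  bound : ∣ n - q * + suc m ∣ Nat.* 2 ≤ suc m
  bound = begin
    ∣ n - q * + suc m ∣ Nat.* 2      ≡⟨ Intₚ.∣i*j∣≡∣i∣*∣j∣ (n - q * + suc m) (+ 2) ⟨
    ∣ (n - q * + suc m) * + 2 ∣      ≡⟨ cong ∣_∣ (twice-distance n q (+ r) (+ suc m) k≡r+q*2m) ⟩
    ∣ + r - + suc m ∣                ≡⟨ cong ∣_∣ (Intₚ.m-n≡m⊖n r (suc m)) ⟩
    ∣ r Int.⊖ suc m ∣                ≤⟨ ∣r⊖n∣≤n r (suc m) (IntDivMod.n%ℕd<d k (suc m Nat.+ suc m)) ⟩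
    suc m                            ∎
    where open Natₚ.≤-Reasoning

sum-of-squares-bound : ∀ A m x y → A Nat.* suc m ≡ x Nat.* x Nat.+ y Nat.* y →
                       x Nat.* 2 ≤ suc m → y Nat.* 2 ≤ suc m → A < suc m
sum-of-squares-bound A m x y eq x≤ y≤ = half<whole A (Natₚ.*-cancelʳ-≤ (A Nat.* 2) (suc m) (suc m Nat.* 2) bound)
  where
  open Nat using (_+_; _*_)
  scale : ∀ A M x y → A * M ≡ x * x + y * y → (A * 2) * (M * 2) ≡ (x * 2) * (x * 2) + (y * 2) * (y * 2)
  scale A M x y eq = trans (lhs A M) (trans (cong (_* 4) eq) (rhs x y))
    where
    lhs : ∀ A M → (A * 2) * (M * 2) ≡ (A * M) * 4
    lhs = ℕSolver.solve-∀
    rhs : ∀ x y → (x * x + y * y) * 4 ≡ (x * 2) * (x * 2) + (y * 2) * (y * 2)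
    rhs = ℕSolver.solve-∀
  double-square : ∀ M → M * M + M * M ≡ M * (M * 2)
  double-square = ℕSolver.solve-∀
  bound : (A * 2) * (suc m * 2) ≤ suc m * (suc m * 2)
  bound = begin
    (A * 2) * (suc m * 2)                    ≡⟨ scale A (suc m) x y eq ⟩
    (x * 2) * (x * 2) + (y * 2) * (y * 2)    ≤⟨ Natₚ.+-mono-≤ (Natₚ.*-mono-≤ x≤ x≤) (Natₚ.*-mono-≤ y≤ y≤) ⟩
    suc m * suc m + suc m * suc m            ≡⟨ double-square (suc m) ⟩
    suc m * (suc m * 2)                      ∎
    where open Natₚ.≤-Reasoning
  half<whole : ∀ A → A * 2 ≤ suc m → A < suc m
  half<whole zero _ = s≤s z≤n
  half<whole (suc A) le = Natₚ.<-≤-trans (Natₚ.m<m*n (suc A) 2 (s≤s (s≤s z≤n))) le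

conjugate : ℤ[i] → ℤ[i]
conjugate (a + b i) = a + (Int.- b) i

norm-conjugate : ∀ x → norm (conjugate x) ≡ norm x
norm-conjugate (a + b i) = cong (λ t → ∣ a ∣ Nat.* ∣ a ∣ Nat.+ t Nat.* t) (Intₚ.∣-i∣≡∣i∣ b)

*ᵍ-conjugate : ∀ x → x *ᵍ conjugate x ≡ normℤ x + (+ 0) i
*ᵍ-conjugate (a + b i) = cong₂ _+_i (re-part a b) (im-part a b)
  where
  open Int using (_+_; _*_; _-_; -_)
  re-part : ∀ a b → a * a - b * (- b) ≡ a * a + b * b
  re-part = ℤSolver.solve-∀
  im-part : ∀ a b → a * (- b) + b * a ≡ + 0
  im-part = ℤSolver.solve-∀

DivMod : ℤ[i] → ℤ[i] → Set
DivMod a b = Σ ℤ[i] λ q → Σ ℤ[i] λ r → (a ≡ q *ᵍ b +ᵍ r) × norm r < norm b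

-- q is a · b̄ divided by the integer N(b) = suc m, rounding each component to the nearest integer.
divMod-norm≡suc : ∀ a b m → norm b ≡ suc m → DivMod a b
divMod-norm≡suc a b m norm-b = q , r , a≡y+[a-y] a (q *ᵍ b) , subst (norm r <_) (sym norm-b) norm-r<
  where
  open Int using (_+_; _*_; _-_; -_)
  c = a *ᵍ conjugate b
  q₁ = proj₁ (nearest-multiple (re c) m)
  q₂ = proj₁ (nearest-multiple (im c) m)
  q = q₁ + q₂ i
  r = a +ᵍ -ᵍ (q *ᵍ b)
  a≡y+[a-y] : ∀ a y → a ≡ y +ᵍ (a +ᵍ -ᵍ y)
  a≡y+[a-y] = Solver.solve-∀ ring
  s₁ = re c - q₁ * + suc m
  s₂ = im c - q₂ * + suc m
  r*b̄-expand : ∀ a q b b̄ → (a +ᵍ -ᵍ (q *ᵍ b)) *ᵍ b̄ ≡ a *ᵍ b̄ +ᵍ -ᵍ (q *ᵍ (b *ᵍ b̄))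
  r*b̄-expand = Solver.solve-∀ ring
  componentwise : ∀ c₁ c₂ q₁ q₂ M → (c₁ + c₂ i) +ᵍ -ᵍ ((q₁ + q₂ i) *ᵍ (M + (+ 0) i)) ≡ (c₁ - q₁ * M) + (c₂ - q₂ * M) i
  componentwise c₁ c₂ q₁ q₂ M = cong₂ _+_i (re-part c₁ q₁ q₂ M) (im-part c₂ q₁ q₂ M)
    where
    re-part : ∀ c q₁ q₂ M → c + - (q₁ * M - q₂ * + 0) ≡ c - q₁ * M
    re-part = ℤSolver.solve-∀
    im-part : ∀ c q₁ q₂ M → c + - (q₁ * + 0 + q₂ * M) ≡ c - q₂ * M
    im-part = ℤSolver.solve-∀
  normℤ-b : normℤ b ≡ + suc m
  normℤ-b = trans (sym (+norm≡normℤ b)) (cong +_ norm-b)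
  r*b̄ : r *ᵍ conjugate b ≡ s₁ + s₂ i
  r*b̄ = begin
    r *ᵍ conjugate b                                 ≡⟨ r*b̄-expand a q b (conjugate b) ⟩
    c +ᵍ -ᵍ (q *ᵍ (b *ᵍ conjugate b))                ≡⟨ cong (λ t → c +ᵍ -ᵍ (q *ᵍ t)) (*ᵍ-conjugate b) ⟩
    c +ᵍ -ᵍ (q *ᵍ (normℤ b + (+ 0) i))               ≡⟨ cong (λ t → c +ᵍ -ᵍ (q *ᵍ (t + (+ 0) i))) normℤ-b ⟩
    c +ᵍ -ᵍ (q *ᵍ ((+ suc m) + (+ 0) i))              ≡⟨ componentwise (re c) (im c) q₁ q₂ (+ suc m) ⟩
    s₁ + s₂ i                                        ∎
    where open ≡-Reasoning
  norm-r*N : norm r Nat.* suc m ≡ ∣ s₁ ∣ Nat.* ∣ s₁ ∣ Nat.+ ∣ s₂ ∣ Nat.* ∣ s₂ ∣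
  norm-r*N = begin
    norm r Nat.* suc m                  ≡⟨ cong (norm r Nat.*_) (trans (norm-conjugate b) norm-b) ⟨
    norm r Nat.* norm (conjugate b)     ≡⟨ norm-* r (conjugate b) ⟨
    norm (r *ᵍ conjugate b)             ≡⟨ cong norm r*b̄ ⟩
    norm (s₁ + s₂ i)                    ∎
    where open ≡-Reasoning
  norm-r< : norm r < suc m
  norm-r< = sum-of-squares-bound (norm r) m ∣ s₁ ∣ ∣ s₂ ∣ norm-r*N
              (proj₂ (nearest-multiple (re c) m)) (proj₂ (nearest-multiple (im c) m))

divMod : ∀ a b → ¬ b ≡ 0ᵍ → DivMod a b
divMod a b b≢0 = divMod-norm≡suc a b (Nat.pred (norm b)) (sym (Natₚ.suc-pred (norm b) {{nonZero}}))
  where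
  nonZero : Nat.NonZero (norm b)
  nonZero = Nat.≢-nonZero (λ norm-b≡0 → b≢0 (norm≡0⇒≡0ᵍ b norm-b≡0))

record Bézout (a b : ℤ[i]) : Set where
  field
    gcd x y : ℤ[i]
    gcd≡ : gcd ≡ x *ᵍ a +ᵍ y *ᵍ b
    gcd∣a : gcd ∣ᵍ a
    gcd∣b : gcd ∣ᵍ b

bézout-acc : ∀ a b → Acc (_<_ on norm) b → Bézout a b
bézout-acc a b (acc smaller) with norm b Nat.≟ 0
... | yes norm-b≡0 = record
  { gcd = a ; x = 1ᵍ ; y = 0ᵍ ; gcd≡ = a≡1a+0b a b ; gcd∣a = ∣ᵍ-refl a
  ; gcd∣b = subst (a ∣ᵍ_) (sym (norm≡0⇒≡0ᵍ b norm-b≡0)) (∣ᵍ-0ᵍ a) }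
  where
  a≡1a+0b : ∀ a b → a ≡ 1ᵍ *ᵍ a +ᵍ 0ᵍ *ᵍ b
  a≡1a+0b = Solver.solve-∀ ring
... | no norm-b≢0 = step (divMod a b (λ b≡0 → norm-b≢0 (cong norm b≡0)))
  where
  step : DivMod a b → Bézout a b
  step (q , r , a≡qb+r , r<b) = record
    { gcd = gcd ; x = y ; y = x +ᵍ -ᵍ (y *ᵍ q)
    ; gcd≡ = trans gcd≡ (sym (trans (cong (λ t → y *ᵍ t +ᵍ (x +ᵍ -ᵍ (y *ᵍ q)) *ᵍ b) a≡qb+r) (regroup x y q b r)))
    ; gcd∣a = subst (gcd ∣ᵍ_) (sym a≡qb+r) (∣ᵍ-+ᵍ (∣ᵍ-*ˡ q gcd∣b) gcd∣r)
    ; gcd∣b = gcd∣b }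
    where
    open Bézout (bézout-acc b r (smaller r<b)) renaming (gcd∣a to gcd∣b; gcd∣b to gcd∣r)
    regroup : ∀ x y q b r → y *ᵍ (q *ᵍ b +ᵍ r) +ᵍ (x +ᵍ -ᵍ (y *ᵍ q)) *ᵍ b ≡ x *ᵍ b +ᵍ y *ᵍ r
    regroup = Solver.solve-∀ ring

bézout : ∀ a b → Bézout a b
bézout a b = bézout-acc a b (On.wellFounded norm Natᵢ.<-wellFounded b)

prime∣*⇒∣⊎∣ : ∀ {p} a b → GaussianPrime p → p ∣ᵍ (a *ᵍ b) → p ∣ᵍ a ⊎ p ∣ᵍ b
prime∣*⇒∣⊎∣ {p} a b (_ , _ , irreducible) p∣ab with bézout p a
... | record { gcd = d ; x = x ; y = y ; gcd≡ = d≡xp+ya ; gcd∣a = k , p≡kd ; gcd∣b = d∣a }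
  with irreducible k d p≡kd
... | inj₁ k∈U = inj₁ (∣ᵍ-trans (k⁻¹ , d≡k⁻¹p) d∣a)
  where
  k⁻¹ = proj₁ (∈U⇒invertible k∈U)
  d≡k⁻¹p : d ≡ k⁻¹ *ᵍ p
  d≡k⁻¹p = begin
    d                  ≡⟨ *ᵍ-identityˡ d ⟨
    1ᵍ *ᵍ d            ≡⟨ cong (_*ᵍ d) (proj₂ (∈U⇒invertible k∈U)) ⟨
    (k⁻¹ *ᵍ k) *ᵍ d    ≡⟨ *ᵍ-assoc k⁻¹ k d ⟩
    k⁻¹ *ᵍ (k *ᵍ d)    ≡⟨ cong (k⁻¹ *ᵍ_) p≡kd ⟨
    k⁻¹ *ᵍ p           ∎
    where open ≡-Reasoning
... | inj₂ d∈U = inj₂ (subst (p ∣ᵍ_) b≡ (∣ᵍ-+ᵍ (∣ᵍ-*ˡ (d⁻¹ *ᵍ x *ᵍ b) (∣ᵍ-refl p)) (∣ᵍ-*ˡ (d⁻¹ *ᵍ y) p∣ab)))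
  where
  d⁻¹ = proj₁ (∈U⇒invertible d∈U)
  regroup : ∀ d⁻¹ x y p a b → (d⁻¹ *ᵍ x *ᵍ b) *ᵍ p +ᵍ (d⁻¹ *ᵍ y) *ᵍ (a *ᵍ b) ≡ d⁻¹ *ᵍ (x *ᵍ p +ᵍ y *ᵍ a) *ᵍ b
  regroup = Solver.solve-∀ ring
  b≡ : (d⁻¹ *ᵍ x *ᵍ b) *ᵍ p +ᵍ (d⁻¹ *ᵍ y) *ᵍ (a *ᵍ b) ≡ b
  b≡ = begin
    (d⁻¹ *ᵍ x *ᵍ b) *ᵍ p +ᵍ (d⁻¹ *ᵍ y) *ᵍ (a *ᵍ b)  ≡⟨ regroup d⁻¹ x y p a b ⟩
    d⁻¹ *ᵍ (x *ᵍ p +ᵍ y *ᵍ a) *ᵍ b                  ≡⟨ cong (λ t → d⁻¹ *ᵍ t *ᵍ b) d≡xp+ya ⟨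
    d⁻¹ *ᵍ d *ᵍ b                                   ≡⟨ cong (_*ᵍ b) (proj₂ (∈U⇒invertible d∈U)) ⟩
    1ᵍ *ᵍ b                                         ≡⟨ *ᵍ-identityˡ b ⟩
    b                                               ∎
    where open ≡-Reasoning

^ᵍ≢0ᵍ : ∀ x k → ¬ x ≡ 0ᵍ → ¬ (x ^ᵍ k) ≡ 0ᵍ
^ᵍ≢0ᵍ x zero _ ()
^ᵍ≢0ᵍ x (suc k) x≢0 xxᵏ≡0 with *ᵍ≡0ᵍ⇒≡0ᵍ⊎≡0ᵍ x (x ^ᵍ k) xxᵏ≡0
... | inj₁ x≡0 = x≢0 x≡0
... | inj₂ xᵏ≡0 = ^ᵍ≢0ᵍ x k x≢0 xᵏ≡0

^ᵍ-distribˡ-+-*ᵍ : ∀ x m n → x ^ᵍ (m Nat.+ n) ≡ x ^ᵍ m *ᵍ x ^ᵍ n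
^ᵍ-distribˡ-+-*ᵍ x zero n = sym (*ᵍ-identityˡ _)
^ᵍ-distribˡ-+-*ᵍ x (suc m) n = trans (cong (x *ᵍ_) (^ᵍ-distribˡ-+-*ᵍ x m n)) (sym (*ᵍ-assoc x _ _))

prime^k∣*⇒∣ : ∀ {p} k m n → GaussianPrime p → ¬ p ∣ᵍ n → (p ^ᵍ k) ∣ᵍ (m *ᵍ n) → (p ^ᵍ k) ∣ᵍ m
prime^k∣*⇒∣ zero m n _ _ _ = m , sym (*ᵍ-identityʳ m)
prime^k∣*⇒∣ {p} (suc k) m n prime p∤n (κ , mn≡κpᵏ⁺¹) = peel (prime∣*⇒∣⊎∣ m n prime p∣mn)
  where
  move-p : ∀ κ p q → κ *ᵍ (p *ᵍ q) ≡ (κ *ᵍ q) *ᵍ p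
  move-p = Solver.solve-∀ ring
  p∣mn : p ∣ᵍ (m *ᵍ n)
  p∣mn = κ *ᵍ p ^ᵍ k , trans mn≡κpᵏ⁺¹ (move-p κ p (p ^ᵍ k))
  peel : p ∣ᵍ m ⊎ p ∣ᵍ n → (p ^ᵍ suc k) ∣ᵍ m
  peel (inj₂ p∣n) = ⊥-elim (p∤n p∣n)
  peel (inj₁ (m′ , m≡m′p)) = lift (prime^k∣*⇒∣ k m′ n prime p∤n (κ , m′n≡κpᵏ))
    where
    swap-p : ∀ p m n → p *ᵍ (m *ᵍ n) ≡ (m *ᵍ p) *ᵍ n
    swap-p = Solver.solve-∀ ring
    pull-p : ∀ κ p q → κ *ᵍ (p *ᵍ q) ≡ p *ᵍ (κ *ᵍ q)
    pull-p = Solver.solve-∀ ring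
    m′n≡κpᵏ : m′ *ᵍ n ≡ κ *ᵍ p ^ᵍ k
    m′n≡κpᵏ = *ᵍ-cancelˡ p _ _ (proj₁ prime)
      (trans (swap-p p m′ n) (trans (cong (_*ᵍ n) (sym m≡m′p)) (trans mn≡κpᵏ⁺¹ (pull-p κ p (p ^ᵍ k)))))
    regroup : ∀ a q p → (a *ᵍ q) *ᵍ p ≡ a *ᵍ (p *ᵍ q)
    regroup = Solver.solve-∀ ring
    lift : (p ^ᵍ k) ∣ᵍ m′ → (p ^ᵍ suc k) ∣ᵍ m
    lift (λ′ , m′≡λ′pᵏ) = λ′ , trans m≡m′p (trans (cong (_*ᵍ p) m′≡λ′pᵏ) (regroup λ′ (p ^ᵍ k) p))

interleaving-All : ∀ {A : Set} {P : A → Set} {l r xs} → Interleaving l r xs → All P xs → All P l × All P r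
interleaving-All [] [] = [] , []
interleaving-All (consˡ sp) (px ∷ pxs) = let (pl , pr) = interleaving-All sp pxs in px ∷ pl , pr
interleaving-All (consʳ sp) (px ∷ pxs) = let (pl , pr) = interleaving-All sp pxs in pl , px ∷ pr

interleaving-AllPairs : ∀ {A : Set} {R : A → A → Set} {l r xs} → Interleaving l r xs →
                        AllPairs R xs → AllPairs R l × AllPairs R r
interleaving-AllPairs [] [] = [] , []
interleaving-AllPairs (consˡ sp) (px ∷ pxs) =
  let (pl , pr) = interleaving-AllPairs sp pxs in proj₁ (interleaving-All sp px) ∷ pl , pr
interleaving-AllPairs (consʳ sp) (px ∷ pxs) =
  let (pl , pr) = interleaving-AllPairs sp pxs in pl , proj₂ (interleaving-All sp px) ∷ pr

prodPow-interleaving : ∀ {l r ps} → Interleaving l r ps → prodPow ps ≡ prodPow l *ᵍ prodPow r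
prodPow-interleaving [] = sym (*ᵍ-identityˡ 1ᵍ)
prodPow-interleaving {l = (p , a) ∷ l} {r} (consˡ sp) =
  trans (cong (p ^ᵍ a *ᵍ_) (prodPow-interleaving sp)) (sym (*ᵍ-assoc (p ^ᵍ a) (prodPow l) (prodPow r)))
prodPow-interleaving {l} {(p , a) ∷ r} (consʳ sp) =
  trans (cong (p ^ᵍ a *ᵍ_) (prodPow-interleaving sp)) (exchange (p ^ᵍ a) (prodPow l) (prodPow r))
  where
  exchange : ∀ x y z → x *ᵍ (y *ᵍ z) ≡ y *ᵍ (x *ᵍ z)
  exchange = Solver.solve-∀ ring

NoCommonPrimeFactor : ℤ[i] → ℤ[i] → Set
NoCommonPrimeFactor m n = ∀ p → GaussianPrime p → p ∣ᵍ m → p ∣ᵍ n → ⊥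

NoCommonPrimeFactor-sym : ∀ {m n} → NoCommonPrimeFactor m n → NoCommonPrimeFactor n m
NoCommonPrimeFactor-sym coprime p prime p∣n p∣m = coprime p prime p∣m p∣n

NoCommonPrimeFactor-∣ˡ : ∀ {m m′ n} → m′ ∣ᵍ m → NoCommonPrimeFactor m n → NoCommonPrimeFactor m′ n
NoCommonPrimeFactor-∣ˡ m′∣m coprime p prime p∣m′ = coprime p prime (∣ᵍ-trans p∣m′ m′∣m)

record SquareSplit (ps : List (ℤ[i] × ℕ)) (m n : ℤ[i]) : Set where
  constructor squareSplit
  field
    {left right} : List (ℤ[i] × ℕ)
    interleaving : Interleaving left right ps
    u v : ℤ[i]
    m≡uL² : m ≡ u *ᵍ (prodPow left *ᵍ prodPow left)
    n≡vR² : n ≡ v *ᵍ (prodPow right *ᵍ prodPow right)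

SquareSplit-sym : ∀ {ps m n} → SquareSplit ps m n → SquareSplit ps n m
SquareSplit-sym (squareSplit sp u v m≡ n≡) = squareSplit (swap sp) v u n≡ m≡

SquareSplit-consˡ : ∀ {p a ps m m′ n} → SquareSplit ps m′ n → m ≡ m′ *ᵍ (p ^ᵍ a *ᵍ p ^ᵍ a) →
                    SquareSplit ((p , a) ∷ ps) m n
SquareSplit-consˡ {p} {a} (squareSplit {l} sp u v m′≡uL² n≡) m≡ =
  squareSplit (consˡ sp) u v (trans m≡ (trans (cong (_*ᵍ (p ^ᵍ a *ᵍ p ^ᵍ a)) m′≡uL²) (regroup u (prodPow l) (p ^ᵍ a)))) n≡
  where
  regroup : ∀ u L q → (u *ᵍ (L *ᵍ L)) *ᵍ (q *ᵍ q) ≡ u *ᵍ ((q *ᵍ L) *ᵍ (q *ᵍ L))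
  regroup = Solver.solve-∀ ring

strip-prime-power : ∀ {p} a s c m n → GaussianPrime p → ¬ p ∣ᵍ n →
  m *ᵍ n ≡ c *ᵍ ((p ^ᵍ a *ᵍ s) *ᵍ (p ^ᵍ a *ᵍ s)) →
  Σ ℤ[i] λ m′ → (m ≡ m′ *ᵍ (p ^ᵍ a *ᵍ p ^ᵍ a)) × (m′ *ᵍ n ≡ c *ᵍ (s *ᵍ s))
strip-prime-power {p} a s c m n prime p∤n mn≡ = strip (prime^k∣*⇒∣ (a Nat.+ a) m n prime p∤n (c *ᵍ (s *ᵍ s) , mn≡′))
  where
  p²ᵃ≡ = ^ᵍ-distribˡ-+-*ᵍ p a a
  separate : ∀ c q s → c *ᵍ ((q *ᵍ s) *ᵍ (q *ᵍ s)) ≡ (c *ᵍ (s *ᵍ s)) *ᵍ (q *ᵍ q)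
  separate = Solver.solve-∀ ring
  mn≡′ : m *ᵍ n ≡ (c *ᵍ (s *ᵍ s)) *ᵍ p ^ᵍ (a Nat.+ a)
  mn≡′ = trans mn≡ (trans (separate c (p ^ᵍ a) s) (cong ((c *ᵍ (s *ᵍ s)) *ᵍ_) (sym p²ᵃ≡)))
  exchange : ∀ x y z → (x *ᵍ y) *ᵍ z ≡ (x *ᵍ z) *ᵍ y
  exchange = Solver.solve-∀ ring
  strip : (p ^ᵍ (a Nat.+ a)) ∣ᵍ m →
          Σ ℤ[i] λ m′ → (m ≡ m′ *ᵍ (p ^ᵍ a *ᵍ p ^ᵍ a)) × (m′ *ᵍ n ≡ c *ᵍ (s *ᵍ s))
  strip (m′ , m≡m′p²ᵃ) = m′ , trans m≡m′p²ᵃ (cong (m′ *ᵍ_) p²ᵃ≡) ,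
    *ᵍ-cancelʳ _ _ _ (^ᵍ≢0ᵍ p (a Nat.+ a) (proj₁ prime))
      (trans (exchange m′ n (p ^ᵍ (a Nat.+ a))) (trans (cong (_*ᵍ n) (sym m≡m′p²ᵃ)) mn≡′))

-- As m and n share no prime, each p^(2a) dividing m · n divides one of them; the interleaving records which.
squareSplit-coprime : ∀ {ps} → All (λ pa → GaussianPrime (proj₁ pa)) ps → ∀ c m n →
  m *ᵍ n ≡ c *ᵍ (prodPow ps *ᵍ prodPow ps) → NoCommonPrimeFactor m n → SquareSplit ps m n
squareSplit-coprime [] c m n _ _ = squareSplit [] m n (sym (*ᵍ-identityʳ m)) (sym (*ᵍ-identityʳ n))
squareSplit-coprime {(p , zero) ∷ ps} (_ ∷ primes) c m n mn≡ coprime =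
  SquareSplit-consˡ (squareSplit-coprime primes c m n mn≡′ coprime) (sym (*ᵍ-identityʳ m))
  where
  mn≡′ : m *ᵍ n ≡ c *ᵍ (prodPow ps *ᵍ prodPow ps)
  mn≡′ = trans mn≡ (cong (λ t → c *ᵍ (t *ᵍ t)) (*ᵍ-identityˡ (prodPow ps)))
squareSplit-coprime {(p , suc a) ∷ ps} (prime ∷ primes) c m n mn≡ coprime =
  place (prime∣*⇒∣⊎∣ m n prime (c *ᵍ (pᵃ *ᵍ s) *ᵍ (p *ᵍ pᵃ *ᵍ s) , trans mn≡ (extract-p c p pᵃ s)))
  where
  s = prodPow ps
  pᵃ = p ^ᵍ a
  extract-p : ∀ c p q s → c *ᵍ ((p *ᵍ q *ᵍ s) *ᵍ (p *ᵍ q *ᵍ s)) ≡ (c *ᵍ (q *ᵍ s) *ᵍ (p *ᵍ q *ᵍ s)) *ᵍ p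
  extract-p = Solver.solve-∀ ring
  absorb : ∀ m n → m *ᵍ n ≡ c *ᵍ (prodPow ((p , suc a) ∷ ps) *ᵍ prodPow ((p , suc a) ∷ ps)) →
           NoCommonPrimeFactor m n → ¬ p ∣ᵍ n → SquareSplit ((p , suc a) ∷ ps) m n
  absorb m n mn≡ coprime p∤n = recurse (strip-prime-power (suc a) s c m n prime p∤n mn≡)
    where
    recurse : Σ ℤ[i] (λ m′ → (m ≡ m′ *ᵍ (p ^ᵍ suc a *ᵍ p ^ᵍ suc a)) × (m′ *ᵍ n ≡ c *ᵍ (s *ᵍ s))) →
              SquareSplit ((p , suc a) ∷ ps) m n
    recurse (m′ , m≡ , m′n≡) = SquareSplit-consˡ (squareSplit-coprime primes c m′ n m′n≡
      (NoCommonPrimeFactor-∣ˡ (p ^ᵍ suc a *ᵍ p ^ᵍ suc a , trans m≡ (*ᵍ-comm m′ _)) coprime)) m≡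
  place : p ∣ᵍ m ⊎ p ∣ᵍ n → SquareSplit ((p , suc a) ∷ ps) m n
  place (inj₁ p∣m) = absorb m n mn≡ coprime (coprime p prime p∣m)
  place (inj₂ p∣n) = SquareSplit-sym (absorb n m (trans (*ᵍ-comm n m) mn≡) (NoCommonPrimeFactor-sym coprime)
                                        (λ p∣m → coprime p prime p∣m p∣n))

1+iᵍ-prime : GaussianPrime 1+iᵍ
1+iᵍ-prime = (λ ()) , (λ { (inj₁ ()) ; (inj₂ (inj₁ ())) ; (inj₂ (inj₂ (inj₁ ()))) ; (inj₂ (inj₂ (inj₂ ()))) }) , factor
  where
  factor : ∀ a b → 1+iᵍ ≡ a *ᵍ b → a ∈U ⊎ b ∈U
  factor a b 1+i≡ab = classify (from-yes (Natᵖ.irreducible? 2) (Natᵈ.divides (norm b) (trans norms (Natₚ.*-comm (norm a) (norm b)))))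
    where
    norms : 2 ≡ norm a Nat.* norm b
    norms = trans (cong norm 1+i≡ab) (norm-* a b)
    classify : norm a ≡ 1 ⊎ norm a ≡ 2 → a ∈U ⊎ b ∈U
    classify (inj₁ norm-a≡1) = inj₁ (norm≡1⇒∈U a norm-a≡1)
    classify (inj₂ norm-a≡2) = inj₂ (norm≡1⇒∈U b (Natₚ.*-cancelˡ-≡ (norm b) 1 2 (trans (cong (Nat._* norm b) (sym norm-a≡2)) (sym norms))))

1+iᵍ∣ᵍ : ∀ a b e → a Int.+ b ≡ e Int.* + 2 → 1+iᵍ ∣ᵍ (a + b i)
1+iᵍ∣ᵍ a b e a+b≡2e = e + (e Int.- a) i , cong₂ _+_i (re-part a e) (trans (im-part a b) (trans (cong (Int._- a) a+b≡2e) (im-part′ a e)))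
  where
  open Int using (_+_; _*_; _-_)
  re-part : ∀ a e → a ≡ e * + 1 - (e - a) * + 1
  re-part = ℤSolver.solve-∀
  im-part : ∀ a b → b ≡ (a + b) - a
  im-part = ℤSolver.solve-∀
  im-part′ : ∀ a e → e * + 2 - a ≡ e * + 1 + (e - a) * + 1
  im-part′ = ℤSolver.solve-∀

OI-form : ∀ {x} → InOI x → Σ ℤ λ k → Σ ℤ λ j → x ≡ (k Int.* + 4 Int.+ + 1) + (j Int.* + 2 Int.- k Int.* + 4) i
OI-form {a + b i} (congr j a+b-1≡2j , congr k a-1≡4k) =
  k , j , cong₂ _+_i (trans (re-part a) (cong (_+ + 1) a-1≡4k)) (trans (im-part a b) (cong₂ _-_ a+b-1≡2j a-1≡4k))
  where
  open Int using (_+_; _*_; _-_)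
  re-part : ∀ a → a ≡ (a - + 1) + + 1
  re-part = ℤSolver.solve-∀
  im-part : ∀ a b → b ≡ ((a + b) - + 1) - (a - + 1)
  im-part = ℤSolver.solve-∀

OI-half-sum-difference : ∀ {x z} → InOI x → InOI z →
  Σ ℤ[i] λ m → Σ ℤ[i] λ n → (x ≡ m -ᵍ n) × (z ≡ m +ᵍ n) × (1+iᵍ ∣ᵍ m ⊎ 1+iᵍ ∣ᵍ n)
OI-half-sum-difference x∈OI z∈OI with OI-form x∈OI | OI-form z∈OI
... | kx , jx , x≡ | kz , jz , z≡ = m , n , trans x≡ (cong₂ _+_i (re-x kx kz) (im-x jx jz kx kz)) ,
                                    trans z≡ (cong₂ _+_i (re-z kx kz) (im-z jx jz kx kz)) ,
                                    even-half ((jx + jz) Int.%ℕ 2) ((jx + jz) Int./ℕ 2)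
                                      (IntDivMod.n%ℕd<d (jx + jz) 2) (IntDivMod.a≡a%ℕn+[a/ℕn]*n (jx + jz) 2)
  where
  open Int using (_+_; _*_; _-_; -_)
  m = (kx * + 2 + kz * + 2 + + 1) + (jx + jz - kx * + 2 - kz * + 2) i
  n = (kz * + 2 - kx * + 2) + (jz - kz * + 2 - jx + kx * + 2) i
  re-x : ∀ kx kz → kx * + 4 + + 1 ≡ (kx * + 2 + kz * + 2 + + 1) + - (kz * + 2 - kx * + 2)
  re-x = ℤSolver.solve-∀
  im-x : ∀ jx jz kx kz → jx * + 2 - kx * + 4 ≡ (jx + jz - kx * + 2 - kz * + 2) + - (jz - kz * + 2 - jx + kx * + 2)
  im-x = ℤSolver.solve-∀
  re-z : ∀ kx kz → kz * + 4 + + 1 ≡ (kx * + 2 + kz * + 2 + + 1) + (kz * + 2 - kx * + 2)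
  re-z = ℤSolver.solve-∀
  im-z : ∀ jx jz kx kz → jz * + 2 - kz * + 4 ≡ (jx + jz - kx * + 2 - kz * + 2) + (jz - kz * + 2 - jx + kx * + 2)
  im-z = ℤSolver.solve-∀
  even-half : ∀ r q → r < 2 → jx + jz ≡ + r + q * + 2 → 1+iᵍ ∣ᵍ m ⊎ 1+iᵍ ∣ᵍ n
  even-half 0 q _ jx+jz≡2q = inj₂ (1+iᵍ∣ᵍ _ _ (q - jx) (trans (sum-n jx jz kx kz) (trans (cong (_- jx * + 2) jx+jz≡2q) (half-n q jx))))
    where
    sum-n : ∀ jx jz kx kz → (kz * + 2 - kx * + 2) + (jz - kz * + 2 - jx + kx * + 2) ≡ (jx + jz) - jx * + 2
    sum-n = ℤSolver.solve-∀
    half-n : ∀ q jx → (+ 0 + q * + 2) - jx * + 2 ≡ (q - jx) * + 2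
    half-n = ℤSolver.solve-∀
  even-half 1 q _ jx+jz≡2q+1 = inj₁ (1+iᵍ∣ᵍ _ _ (q + + 1) (trans (sum-m jx jz kx kz) (trans (cong (_+ + 1) jx+jz≡2q+1) (half-m q))))
    where
    sum-m : ∀ jx jz kx kz → (kx * + 2 + kz * + 2 + + 1) + (jx + jz - kx * + 2 - kz * + 2) ≡ (jx + jz) + + 1
    sum-m = ℤSolver.solve-∀
    half-m : ∀ q → (+ 1 + q * + 2) + + 1 ≡ (q + + 1) * + 2
    half-m = ℤSolver.solve-∀
  even-half (suc (suc r)) q (s≤s (s≤s ())) _

-- The solver cannot read _^ᵍ_, so its lemmas below write x ^ᵍ 2 unfolded as x *ᵍ (x *ᵍ 1ᵍ).
halves-pythagorean : ∀ m n w → (m -ᵍ n) ^ᵍ 2 +ᵍ ((1+iᵍ ^ᵍ 2) *ᵍ w) ^ᵍ 2 ≡ (m +ᵍ n) ^ᵍ 2 → m *ᵍ n ≡ (-ᵍ 1ᵍ) *ᵍ (w *ᵍ w)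
halves-pythagorean m n w pythagoras = *ᵍ-cancelˡ four _ _ (λ ()) (begin
  four *ᵍ (m *ᵍ n)                                     ≡⟨ difference-of-squares m n ⟩
  (m +ᵍ n) ^ᵍ 2 -ᵍ (m -ᵍ n) ^ᵍ 2                       ≡⟨ cong (_-ᵍ (m -ᵍ n) ^ᵍ 2) pythagoras ⟨
  (m -ᵍ n) ^ᵍ 2 +ᵍ ((1+iᵍ ^ᵍ 2) *ᵍ w) ^ᵍ 2 -ᵍ (m -ᵍ n) ^ᵍ 2  ≡⟨ square-of-2iw (m -ᵍ n) w ⟩
  four *ᵍ ((-ᵍ 1ᵍ) *ᵍ (w *ᵍ w))                        ∎)
  where
  open ≡-Reasoning
  four = (+ 4) + (+ 0) i
  difference-of-squares : ∀ m n → four *ᵍ (m *ᵍ n) ≡ (m +ᵍ n) *ᵍ ((m +ᵍ n) *ᵍ 1ᵍ) -ᵍ (m -ᵍ n) *ᵍ ((m -ᵍ n) *ᵍ 1ᵍ)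
  difference-of-squares = Solver.solve-∀ ring
  square-of-2iw : ∀ a w → a *ᵍ (a *ᵍ 1ᵍ) +ᵍ ((1+iᵍ *ᵍ (1+iᵍ *ᵍ 1ᵍ)) *ᵍ w) *ᵍ (((1+iᵍ *ᵍ (1+iᵍ *ᵍ 1ᵍ)) *ᵍ w) *ᵍ 1ᵍ)
                           -ᵍ a *ᵍ (a *ᵍ 1ᵍ) ≡ four *ᵍ ((-ᵍ 1ᵍ) *ᵍ (w *ᵍ w))
  square-of-2iw = Solver.solve-∀ ring

*ᵍ≡-1ᵍ⇒i-power : ∀ u v → u *ᵍ v ≡ -ᵍ 1ᵍ →
  Σ ℕ λ t → t ≤ 3 × (u ≡ iᵍ ^ᵍ (1 Nat.+ t)) × (v ≡ iᵍ ^ᵍ (1 Nat.+ t) *ᵍ (-ᵍ 1ᵍ) ^ᵍ t)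
*ᵍ≡-1ᵍ⇒i-power u v uv≡-1 = power (*ᵍ≡1ᵍ⇒∈U u (-ᵍ v) (trans (*ᵍ-neg u v) (cong -ᵍ_ uv≡-1)))
  where
  *ᵍ-neg : ∀ u v → u *ᵍ (-ᵍ v) ≡ -ᵍ (u *ᵍ v)
  *ᵍ-neg = Solver.solve-∀ ring
  power : u ∈U → Σ ℕ λ t → t ≤ 3 × (u ≡ iᵍ ^ᵍ (1 Nat.+ t)) × (v ≡ iᵍ ^ᵍ (1 Nat.+ t) *ᵍ (-ᵍ 1ᵍ) ^ᵍ t)
  power (inj₁ refl) = 3 , s≤s (s≤s (s≤s z≤n)) , refl , *ᵍ-cancelˡ u _ _ (λ ()) (trans uv≡-1 refl)
  power (inj₂ (inj₁ refl)) = 1 , s≤s z≤n , refl , *ᵍ-cancelˡ u _ _ (λ ()) (trans uv≡-1 refl)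
  power (inj₂ (inj₂ (inj₁ refl))) = 0 , z≤n , refl , *ᵍ-cancelˡ u _ _ (λ ()) (trans uv≡-1 refl)
  power (inj₂ (inj₂ (inj₂ refl))) = 2 , s≤s (s≤s z≤n) , refl , *ᵍ-cancelˡ u _ _ (λ ()) (trans uv≡-1 refl)

InG-interleaving : ∀ {l r ps} → Interleaving l r ps → Unique (map proj₁ ps) →
  All (λ pa → GaussianPrime (proj₁ pa) × InOI (proj₁ pa)) ps →
  ∀ a → InG (1+iᵍ ^ᵍ a *ᵍ prodPow l) × InG (prodPow r)
InG-interleaving {l} {r} sp distinct primes a =
  (a , l , AllPairs.map⁺ distinctˡ , primesˡ , refl) ,
  (0 , r , AllPairs.map⁺ distinctʳ , primesʳ , sym (*ᵍ-identityˡ (prodPow r)))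
  where
  distinctˡ = proj₁ (interleaving-AllPairs sp (AllPairs.map⁻ distinct))
  distinctʳ = proj₂ (interleaving-AllPairs sp (AllPairs.map⁻ distinct))
  primesˡ = proj₁ (interleaving-All sp primes)
  primesʳ = proj₂ (interleaving-All sp primes)

record SquareFactorisation (w m n : ℤ[i]) : Set where
  field
    P Q u v : ℤ[i]
    P∈G : InG P
    Q∈G : InG Q
    PQ≡w : P *ᵍ Q ≡ w
    m≡uP² : m ≡ u *ᵍ (P *ᵍ P)
    n≡vQ² : n ≡ v *ᵍ (Q *ᵍ Q)

InG-squareFactorisation : ∀ {w m n} c → InG w → m *ᵍ n ≡ c *ᵍ (w *ᵍ w) → NoCommonPrimeFactor m n →
                          SquareFactorisation w m n
InG-squareFactorisation {w} {m} {n} c (a₁ , ps , distinct , primes , w≡) mn≡ coprime =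
  fromSplit (squareSplit-coprime (1+iᵍ-prime ∷ All.map proj₁ primes) c m n
              (trans mn≡ (cong (λ t → c *ᵍ (t *ᵍ t)) w≡)) coprime)
  where
  fromSplit : SquareSplit ((1+iᵍ , a₁) ∷ ps) m n → SquareFactorisation w m n
  fromSplit (squareSplit {.(1+iᵍ , a₁) ∷ l} {r} (consˡ sp) u v m≡ n≡) = record
    { P = 1+iᵍ ^ᵍ a₁ *ᵍ prodPow l ; Q = prodPow r ; u = u ; v = v
    ; P∈G = proj₁ (InG-interleaving sp distinct primes a₁)
    ; Q∈G = proj₂ (InG-interleaving sp distinct primes a₁)
    ; PQ≡w = sym (trans w≡ (prodPow-interleaving {l = (1+iᵍ , a₁) ∷ l} (consˡ sp)))
    ; m≡uP² = m≡ ; n≡vQ² = n≡ }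
  fromSplit (squareSplit {l} {.(1+iᵍ , a₁) ∷ r} (consʳ sp) u v m≡ n≡) = record
    { P = prodPow l ; Q = 1+iᵍ ^ᵍ a₁ *ᵍ prodPow r ; u = u ; v = v
    ; P∈G = proj₂ (InG-interleaving (swap sp) distinct primes a₁)
    ; Q∈G = proj₁ (InG-interleaving (swap sp) distinct primes a₁)
    ; PQ≡w = sym (trans w≡ (prodPow-interleaving {r = (1+iᵍ , a₁) ∷ r} (consʳ sp)))
    ; m≡uP² = m≡ ; n≡vQ² = n≡ }

prime∣-square⇒∣ : ∀ {p} w → GaussianPrime p → p ∣ᵍ ((-ᵍ 1ᵍ) *ᵍ (w *ᵍ w)) → p ∣ᵍ w
prime∣-square⇒∣ {p} w prime@(_ , p∉U , _) p∣-w² = from-square (prime∣*⇒∣⊎∣ (-ᵍ 1ᵍ) (w *ᵍ w) prime p∣-w²)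
  where
  neg-* : ∀ p κ → p *ᵍ (-ᵍ κ) ≡ -ᵍ (κ *ᵍ p)
  neg-* = Solver.solve-∀ ring
  from-square : p ∣ᵍ (-ᵍ 1ᵍ) ⊎ p ∣ᵍ (w *ᵍ w) → p ∣ᵍ w
  from-square (inj₁ (κ , -1≡κp)) = ⊥-elim (p∉U (*ᵍ≡1ᵍ⇒∈U p (-ᵍ κ) (trans (neg-* p κ) (cong -ᵍ_ (sym -1≡κp)))))
  from-square (inj₂ p∣w²) = reduce (prime∣*⇒∣⊎∣ w w prime p∣w²)

halves-coprime : ∀ {m n w} → Coprimeᵍ (m -ᵍ n) ((1+iᵍ ^ᵍ 2) *ᵍ w) →
                 m *ᵍ n ≡ (-ᵍ 1ᵍ) *ᵍ (w *ᵍ w) → NoCommonPrimeFactor m n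
halves-coprime {m} {n} {w} coprime mn≡ p prime@(_ , p∉U , _) p∣m p∣n =
  p∉U (coprime p (∣ᵍ-difference p∣m p∣n) (∣ᵍ-*ˡ (1+iᵍ ^ᵍ 2) (prime∣-square⇒∣ w prime (subst (p ∣ᵍ_) mn≡ (∣ᵍ-*ʳ n p∣m)))))

Coprimeᵍ-parametrisation : ∀ {P Q} u s c → Coprimeᵍ (u *ᵍ (P ^ᵍ 2 -ᵍ s *ᵍ Q ^ᵍ 2)) (c *ᵍ (P *ᵍ Q)) → Coprimeᵍ P Q
Coprimeᵍ-parametrisation {P} {Q} u s c coprime d d∣P d∣Q =
  coprime d (∣ᵍ-*ˡ u (∣ᵍ-difference (∣ᵍ-*ˡ P (∣ᵍ-*ʳ 1ᵍ d∣P)) (∣ᵍ-*ˡ s (∣ᵍ-*ˡ Q (∣ᵍ-*ʳ 1ᵍ d∣Q))))) (∣ᵍ-*ˡ c (∣ᵍ-*ʳ Q d∣P))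

record HalvesParametrisation (w m n : ℤ[i]) : Set where
  field
    t : ℕ
    t≤3 : t ≤ 3
    P Q : ℤ[i]
    P∈G : InG P
    Q∈G : InG Q
    PQ≡w : P *ᵍ Q ≡ w
    m-n≡ : m -ᵍ n ≡ iᵍ ^ᵍ (1 Nat.+ t) *ᵍ (P ^ᵍ 2 -ᵍ (-ᵍ 1ᵍ) ^ᵍ t *ᵍ Q ^ᵍ 2)
    m+n≡ : m +ᵍ n ≡ iᵍ ^ᵍ (1 Nat.+ t) *ᵍ (P ^ᵍ 2 +ᵍ (-ᵍ 1ᵍ) ^ᵍ t *ᵍ Q ^ᵍ 2)

halves-parametrisation : ∀ {w m n} → InG w → ¬ w ≡ 0ᵍ → m *ᵍ n ≡ (-ᵍ 1ᵍ) *ᵍ (w *ᵍ w) →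
                         NoCommonPrimeFactor m n → HalvesParametrisation w m n
halves-parametrisation {w} {m} {n} w∈G w≢0 mn≡ coprime = record
  { t = t ; t≤3 = t≤3 ; P = P ; Q = Q ; P∈G = P∈G ; Q∈G = Q∈G ; PQ≡w = PQ≡w
  ; m-n≡ = trans (cong₂ _-ᵍ_ m≡ n≡) (factor-difference (iᵍ ^ᵍ (1 Nat.+ t)) s P Q)
  ; m+n≡ = trans (cong₂ _+ᵍ_ m≡ n≡) (factor-sum (iᵍ ^ᵍ (1 Nat.+ t)) s P Q) }
  where
  open SquareFactorisation (InG-squareFactorisation (-ᵍ 1ᵍ) w∈G mn≡ coprime)
  regroup : ∀ u v P Q → (u *ᵍ v) *ᵍ ((P *ᵍ Q) *ᵍ (P *ᵍ Q)) ≡ (u *ᵍ (P *ᵍ P)) *ᵍ (v *ᵍ (Q *ᵍ Q))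
  regroup = Solver.solve-∀ ring
  uv≡-1 : u *ᵍ v ≡ -ᵍ 1ᵍ
  uv≡-1 = *ᵍ-cancelʳ (w *ᵍ w) _ _ w²≢0 (begin
    (u *ᵍ v) *ᵍ (w *ᵍ w)                  ≡⟨ cong (λ x → (u *ᵍ v) *ᵍ (x *ᵍ x)) PQ≡w ⟨
    (u *ᵍ v) *ᵍ ((P *ᵍ Q) *ᵍ (P *ᵍ Q))    ≡⟨ regroup u v P Q ⟩
    (u *ᵍ (P *ᵍ P)) *ᵍ (v *ᵍ (Q *ᵍ Q))    ≡⟨ cong₂ _*ᵍ_ m≡uP² n≡vQ² ⟨
    m *ᵍ n                                ≡⟨ mn≡ ⟩
    (-ᵍ 1ᵍ) *ᵍ (w *ᵍ w)                   ∎)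
    where
    open ≡-Reasoning
    w²≢0 : ¬ w *ᵍ w ≡ 0ᵍ
    w²≢0 w²≡0 = w≢0 (reduce (*ᵍ≡0ᵍ⇒≡0ᵍ⊎≡0ᵍ w w w²≡0))
  power = *ᵍ≡-1ᵍ⇒i-power u v uv≡-1
  t = proj₁ power
  t≤3 = proj₁ (proj₂ power)
  u≡ = proj₁ (proj₂ (proj₂ power))
  v≡ = proj₂ (proj₂ (proj₂ power))
  s = (-ᵍ 1ᵍ) ^ᵍ t
  m≡ : m ≡ iᵍ ^ᵍ (1 Nat.+ t) *ᵍ (P *ᵍ P)
  m≡ = trans m≡uP² (cong (_*ᵍ (P *ᵍ P)) u≡)
  n≡ : n ≡ (iᵍ ^ᵍ (1 Nat.+ t) *ᵍ s) *ᵍ (Q *ᵍ Q)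
  n≡ = trans n≡vQ² (cong (_*ᵍ (Q *ᵍ Q)) v≡)
  factor-difference : ∀ u s P Q → u *ᵍ (P *ᵍ P) -ᵍ (u *ᵍ s) *ᵍ (Q *ᵍ Q) ≡ u *ᵍ (P *ᵍ (P *ᵍ 1ᵍ) -ᵍ s *ᵍ (Q *ᵍ (Q *ᵍ 1ᵍ)))
  factor-difference = Solver.solve-∀ ring
  factor-sum : ∀ u s P Q → u *ᵍ (P *ᵍ P) +ᵍ (u *ᵍ s) *ᵍ (Q *ᵍ Q) ≡ u *ᵍ (P *ᵍ (P *ᵍ 1ᵍ) +ᵍ s *ᵍ (Q *ᵍ (Q *ᵍ 1ᵍ)))
  factor-sum = Solver.solve-∀ ring

theorem4p4 : (X Y Z : ℤ[i]) → InOI X → InOI Z →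
    Σ ℤ[i] (λ W → InG W × (Y ≡ (1+iᵍ ^ᵍ 2) *ᵍ W)) →
    (X ^ᵍ 2) +ᵍ (Y ^ᵍ 2) ≡ Z ^ᵍ 2 →
    Coprimeᵍ X Y →
    ¬ (X *ᵍ Y *ᵍ Z ≡ 0ᵍ) →
    Σ ℕ λ t → t ≤ 3 × Σ ℤ[i] λ P → Σ ℤ[i] λ Q →
      InG P × InG Q × Coprimeᵍ P Q × (1+iᵍ ∣ᵍ (P *ᵍ Q)) ×
      (X ≡ (iᵍ ^ᵍ (1 Data.Nat.+ t)) *ᵍ ((P ^ᵍ 2) -ᵍ ((-ᵍ 1ᵍ) ^ᵍ t) *ᵍ (Q ^ᵍ 2))) ×
      (Y ≡ (1+iᵍ ^ᵍ 2) *ᵍ (P *ᵍ Q)) ×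
      (Z ≡ (iᵍ ^ᵍ (1 Data.Nat.+ t)) *ᵍ ((P ^ᵍ 2) +ᵍ ((-ᵍ 1ᵍ) ^ᵍ t) *ᵍ (Q ^ᵍ 2)))
theorem4p4 X Y Z X∈OI Z∈OI (W , W∈G , Y≡) pythagoras X⊥Y XYZ≢0 with OI-half-sum-difference X∈OI Z∈OI
... | M , N , X≡M-N , Z≡M+N , 1+i∣M⊎N =
  t , t≤3 , P , Q , P∈G , Q∈G , P⊥Q , 1+i∣PQ , X≡ , Y≡PQ , Z≡
  where
  MN≡-W² : M *ᵍ N ≡ (-ᵍ 1ᵍ) *ᵍ (W *ᵍ W)
  MN≡-W² = halves-pythagorean M N W
    (trans (sym (cong₂ (λ x y → x ^ᵍ 2 +ᵍ y ^ᵍ 2) X≡M-N Y≡)) (trans pythagoras (cong (_^ᵍ 2) Z≡M+N)))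
  W≢0 : ¬ W ≡ 0ᵍ
  W≢0 W≡0 = XYZ≢0 (trans (cong (λ y → X *ᵍ y *ᵍ Z) (trans Y≡ (cong ((1+iᵍ ^ᵍ 2) *ᵍ_) W≡0))) (annihilate X (1+iᵍ ^ᵍ 2) Z))
    where
    annihilate : ∀ x c z → x *ᵍ (c *ᵍ 0ᵍ) *ᵍ z ≡ 0ᵍ
    annihilate = Solver.solve-∀ ring
  open HalvesParametrisation (halves-parametrisation W∈G W≢0 MN≡-W² (halves-coprime {M} {N} {W} (subst₂ Coprimeᵍ X≡M-N Y≡ X⊥Y) MN≡-W²))
  X≡ = trans X≡M-N m-n≡
  Z≡ = trans Z≡M+N m+n≡
  Y≡PQ = trans Y≡ (cong ((1+iᵍ ^ᵍ 2) *ᵍ_) (sym PQ≡w))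
  P⊥Q = Coprimeᵍ-parametrisation (iᵍ ^ᵍ (1 Nat.+ t)) ((-ᵍ 1ᵍ) ^ᵍ t) (1+iᵍ ^ᵍ 2) (subst₂ Coprimeᵍ X≡ Y≡PQ X⊥Y)
  1+i∣PQ = subst (1+iᵍ ∣ᵍ_) (sym PQ≡w) (prime∣-square⇒∣ W 1+iᵍ-prime (subst (1+iᵍ ∣ᵍ_) MN≡-W² ([ ∣ᵍ-*ʳ N , ∣ᵍ-*ˡ M ] 1+i∣M⊎N)))
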